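{- Let $N,k$ be positive integers with $k>1$, and let $p$ denote the straight polyomino of size $k$. Then the smallest polyomino which contains at least $N$ distinct instances of $p$ is the straight polyomino of size $N+k-1$.
   Context: Cells are the unit squares of the square lattice, indexed by integer coordinates $(x,y)$. A polyomino is a finite nonempty edge-connected set of cells; its size is its number of cells; polyominoes are considered up to translation. A straight polyomino of size $k\ge 2$ is a polyomino consisting of $k$ consecutive cells in a single horizontal row (only this horizontal orientation is considered). An instance of a shape $p$ is a translate of $p$; an instance of $p$ in $P$ is one contained in $P$. -}

module Defs where

open import Data.Nat using (ℕ; _≤_)
open import Data.Integer using (ℤ; +_; _+_; _-_; 0ℤ; 1ℤ)
open import Data.Product using (_×_; _,_; ∃)
open import Data.Sum using (_⊎_)
open import Data.List using (List; []; map; length; upTo)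
open import Data.List.Membership.Propositional using (_∈_)
open import Data.List.Relation.Unary.All using (All)
open import Data.List.Relation.Unary.Unique.Propositional using (Unique)
open import Relation.Binary.PropositionalEquality using (_≡_; _≢_)

Cell : Set
Cell = ℤ × ℤ

Adjacent : Cell → Cell → Set
Adjacent (x , y) d =
  (d ≡ (x + 1ℤ , y)) ⊎ (d ≡ (x - 1ℤ , y)) ⊎ (d ≡ (x , y + 1ℤ)) ⊎ (d ≡ (x , y - 1ℤ))

data Reach (P : List Cell) : Cell → Cell → Set where
  here : ∀ {c} → Reach P c c
  step : ∀ {c c' d} → Adjacent c c' → c' ∈ P → Reach P c' d → Reach P c d

EdgeConnected : List Cell → Set
EdgeConnected P = ∀ c d → c ∈ P → d ∈ P → Reach P c d

-- A polyomino is represented by the duplicate-free list of its cells: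
-- finite, nonempty, edge-connected.
IsPolyomino : List Cell → Set
IsPolyomino P = Unique P × (P ≢ []) × EdgeConnected P

size : List Cell → ℕ
size = length

translate : Cell → Cell → Cell
translate (a , b) (x , y) = (x + a , y + b)

straight : ℕ → List Cell
straight k = map (λ i → (+ i , 0ℤ)) (upTo k)

InstanceAt : List Cell → List Cell → Cell → Set
InstanceAt p P v = All (λ c → translate v c ∈ P) p

-- P contains at least N distinct instances of p
-- (distinct instances = distinct translation vectors)
HasAtLeast : ℕ → List Cell → List Cell → Set
HasAtLeast N p P =
  ∃ λ (vs : List Cell) → (N ≤ length vs) × Unique vs × All (InstanceAt p P) vs

SameCells : List Cell → List Cell → Set
SameCells A B = ∀ c → ((c ∈ A → c ∈ B) × (c ∈ B → c ∈ A))

TranslateOf : List Cell → List Cell → Set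
TranslateOf P Q = ∃ λ v → SameCells (map (translate v) P) Q

{-# OPTIONS --safe #-}
-- Order cells row by row and call the translation vectors of the N instances their left ends.
-- P contains every left end and also the k − 1 cells to the right of the last left end; those
-- cells lie beyond every left end, so |P| ≥ N + k − 1.  If equality holds, P consists of exactly
-- these cells. Then the right neighbour of every left end except the last is again a left end.
-- Stepping right from the first left end therefore stays among the left ends until the last one
-- is reached, and reaching it early would confine all N left ends to a shorter run. So the left
-- ends form a horizontal run of N cells, and P is the straight polyomino that starts there.
module Submission where

open import Defs
open import Level using (0ℓ)
open import Data.Nat as ℕ using (ℕ; zero; suc; _+_; _∸_; _≤_; _<_; _≤′_; z≤n; s≤s)
import Data.Nat.Properties as ℕP
open import Data.Integer as ℤ using (ℤ; +_; 0ℤ)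
import Data.Integer.Properties as ℤP
open import Data.Integer.Tactic.RingSolver using (solve-∀)
open import Data.Product using (_×_; _,_; ∃; proj₁; proj₂; swap)
open import Data.Product.Properties using (≡-dec)
open import Data.Product.Relation.Binary.Lex.NonStrict using (×-totalOrder)
open import Data.Sum using (inj₁; inj₂)
open import Function using (_∘_)
open import Data.List using (List; []; _∷_; map; length; upTo; applyUpTo; _++_)
open import Data.List.Properties using (length-map; length-upTo; length-applyUpTo; length-++; length-removeAt′)
open import Data.List.Membership.Propositional using (_∈_; _∉_)
open import Data.List.Membership.Propositional.Properties
  using (∈-map⁺; ∈-map⁻; ∈-upTo⁺; ∈-upTo⁻; ∈-applyUpTo⁺; ∈-applyUpTo⁻; ∈-++⁻)
open import Data.List.Relation.Binary.Subset.Propositional using (_⊆_)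
open import Data.List.Relation.Unary.Any using (here; there; _─_; index)
open import Data.List.Relation.Unary.All as All using (All; _∷_)
import Data.List.Relation.Unary.All.Properties as AllP
open import Data.List.Relation.Unary.AllPairs using (_∷_)
open import Data.List.Relation.Unary.Unique.Propositional using (Unique)
import Data.List.Relation.Unary.Unique.Propositional.Properties as UniqueP
open import Relation.Binary.Bundles using (TotalOrder)
open import Relation.Binary.Definitions using (DecidableEquality)
open import Relation.Binary.PropositionalEquality
open import Relation.Nullary using (¬_; yes; no; contradiction)
open import Algebra.Properties.AbelianGroup ℤP.+-0-abelianGroup using (∙-cancelˡ; ∙-cancelʳ)

module _ {A : Set} where

  ∈-─ : ∀ {a x} {ys : List A} (a∈ys : a ∈ ys) → x ∈ ys → x ≢ a → x ∈ (ys ─ a∈ys)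
  ∈-─ (here refl) (here refl) x≢a = contradiction refl x≢a
  ∈-─ (here refl) (there x∈ys) _  = x∈ys
  ∈-─ (there _)   (here refl) _   = here refl
  ∈-─ (there a∈ys) (there x∈ys) x≢a = there (∈-─ a∈ys x∈ys x≢a)

  unique-⊆⇒length≤ : {xs ys : List A} → Unique xs → xs ⊆ ys → length xs ≤ length ys
  unique-⊆⇒length≤ {[]}     _              _     = z≤n
  unique-⊆⇒length≤ {x ∷ xs} {ys} (x∉xs ∷ xs-unique) xs⊆ys = begin
    suc (length xs)         ≤⟨ s≤s (unique-⊆⇒length≤ xs-unique xs⊆ys─x) ⟩
    suc (length (ys ─ x∈ys)) ≡⟨ length-removeAt′ ys (index x∈ys) ⟨
    length ys               ∎
    where
    open ℕP.≤-Reasoning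
    x∈ys = xs⊆ys (here refl)
    xs⊆ys─x : xs ⊆ (ys ─ x∈ys)
    xs⊆ys─x y∈xs = ∈-─ x∈ys (xs⊆ys (there y∈xs)) (≢-sym (All.lookup x∉xs y∈xs))

module _ {A : Set} (_≟_ : DecidableEquality A) where
  open import Data.List.Membership.DecPropositional _≟_ using (_∈?_)

  unique-⊆-length≥⇒⊇ : {xs ys : List A} → Unique xs → xs ⊆ ys → length ys ≤ length xs → ys ⊆ xs
  unique-⊆-length≥⇒⊇ {xs} {ys} xs-unique xs⊆ys ys≤xs {y} y∈ys with y ∈? xs
  ... | yes y∈xs = y∈xs
  ... | no  y∉xs = contradiction (unique-⊆⇒length≤ y∷xs-unique y∷xs⊆ys) (ℕP.<⇒≱ (s≤s ys≤xs))
    where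
    y∷xs-unique : Unique (y ∷ xs)
    y∷xs-unique = All.tabulate (λ { x∈xs refl → y∉xs x∈xs }) ∷ xs-unique
    y∷xs⊆ys : y ∷ xs ⊆ ys
    y∷xs⊆ys (here refl)  = y∈ys
    y∷xs⊆ys (there x∈xs) = xs⊆ys x∈xs

+-cancelˡ-≤ : ∀ a {i j} → a ℤ.+ i ℤ.≤ a ℤ.+ j → i ℤ.≤ j
+-cancelˡ-≤ a {i} {j} le = subst₂ ℤ._≤_ (-a+[a+i]≡i a i) (-a+[a+i]≡i a j) (ℤP.+-monoʳ-≤ (ℤ.- a) le)
  where
  -a+[a+i]≡i : ∀ a i → ℤ.- a ℤ.+ (a ℤ.+ i) ≡ i
  -a+[a+i]≡i = solve-∀

i≤j⇒∃[n]i+n≡j : ∀ {i j} → i ℤ.≤ j → ∃ λ n → i ℤ.+ + n ≡ j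
i≤j⇒∃[n]i+n≡j {i} {j} i≤j = ℤ.∣ j ℤ.- i ∣ , (begin
  i ℤ.+ + ℤ.∣ j ℤ.- i ∣  ≡⟨ cong (λ z → i ℤ.+ z) (ℤP.0≤i⇒+∣i∣≡i (ℤP.i≤j⇒0≤j-i i≤j)) ⟩
  i ℤ.+ (j ℤ.- i)        ≡⟨ i+[j-i]≡j i j ⟩
  j                      ∎)
  where
  open ≡-Reasoning
  i+[j-i]≡j : ∀ i j → i ℤ.+ (j ℤ.- i) ≡ j
  i+[j-i]≡j = solve-∀

infixl 6 _⊕_

_⊕_ : Cell → ℕ → Cell
(x , y) ⊕ i = (x ℤ.+ + i , y)

⊕-identityʳ : ∀ v → v ⊕ 0 ≡ v
⊕-identityʳ (x , y) = cong (_, y) (ℤP.+-identityʳ x)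

⊕-assoc : ∀ v i j → v ⊕ i ⊕ j ≡ v ⊕ (i + j)
⊕-assoc (x , y) i j = cong (_, y) (begin
  x ℤ.+ + i ℤ.+ + j     ≡⟨ ℤP.+-assoc x (+ i) (+ j) ⟩
  x ℤ.+ (+ i ℤ.+ + j)   ≡⟨ cong (λ z → x ℤ.+ z) (ℤP.pos-+ i j) ⟨
  x ℤ.+ + (i + j)       ∎)
  where open ≡-Reasoning

⊕-suc : ∀ v i → v ⊕ i ⊕ 1 ≡ v ⊕ suc i
⊕-suc v i = trans (⊕-assoc v i 1) (cong (v ⊕_) (ℕP.+-comm i 1))

⊕-cancelʳ : ∀ {u v} i → u ⊕ i ≡ v ⊕ i → u ≡ v
⊕-cancelʳ i eq = cong₂ _,_ (∙-cancelʳ (+ i) _ _ (cong proj₁ eq)) (cong proj₂ eq)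

⊕-cancelˡ : ∀ v {i j} → v ⊕ i ≡ v ⊕ j → i ≡ j
⊕-cancelˡ (x , _) eq = ℤP.+-injective (∙-cancelˡ x _ _ (cong proj₁ eq))

translate-straight : ∀ v i → translate v (+ i , 0ℤ) ≡ v ⊕ i
translate-straight (x , y) i = cong₂ _,_ (ℤP.+-comm (+ i) x) (ℤP.+-identityˡ y)

translate-cancelˡ : ∀ v {c d} → translate v c ≡ translate v d → c ≡ d
translate-cancelˡ (a , b) eq = cong₂ _,_ (∙-cancelʳ a _ _ (cong proj₁ eq)) (∙-cancelʳ b _ _ (cong proj₂ eq))

∈-straight⁺ : ∀ {n i} → i < n → (+ i , 0ℤ) ∈ straight n
∈-straight⁺ i<n = ∈-map⁺ _ (∈-upTo⁺ i<n)

∈-straight⁻ : ∀ {n c} → c ∈ straight n → ∃ λ i → i < n × c ≡ (+ i , 0ℤ)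
∈-straight⁻ c∈ with i , i∈ , refl ← ∈-map⁻ _ c∈ = i , ∈-upTo⁻ i∈ , refl

length-straight : ∀ n → length (straight n) ≡ n
length-straight n = trans (length-map _ (upTo n)) (length-upTo n)

straight-unique : ∀ n → Unique (straight n)
straight-unique n = UniqueP.map⁺ (ℤP.+-injective ∘ cong proj₁) (UniqueP.upTo⁺ n)

reach-snoc : ∀ {P c d e} → Reach P c d → Adjacent d e → e ∈ P → Reach P c e
reach-snoc here             d~e e∈P = step d~e e∈P here
reach-snoc (step c~c' c'∈P r) d~e e∈P = step c~c' c'∈P (reach-snoc r d~e e∈P)

module _ {n : ℕ} where

  reach-rightward : ∀ {i j} → i ≤′ j → j < n → Reach (straight n) (+ i , 0ℤ) (+ j , 0ℤ)
  reach-rightward ℕ.≤′-refl        _   = here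
  reach-rightward (ℕ.≤′-step i≤′j) j<n =
    reach-snoc (reach-rightward i≤′j (ℕP.<-trans (ℕP.n<1+n _) j<n))
      (inj₁ (cong (λ m → (+ m , 0ℤ)) (ℕP.+-comm 1 _))) (∈-straight⁺ j<n)

  reach-leftward : ∀ {i j} → j ≤′ i → i < n → Reach (straight n) (+ i , 0ℤ) (+ j , 0ℤ)
  reach-leftward ℕ.≤′-refl        _   = here
  reach-leftward (ℕ.≤′-step j≤′i) i<n =
    step (inj₂ (inj₁ refl)) (∈-straight⁺ i-1<n) (reach-leftward j≤′i i-1<n)
    where i-1<n = ℕP.<-trans (ℕP.n<1+n _) i<n

  straight-connected : EdgeConnected (straight n)
  straight-connected c d c∈ d∈
    with i , i<n , refl ← ∈-straight⁻ c∈ | j , j<n , refl ← ∈-straight⁻ d∈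
       | ℕP.≤-total i j
  ... | inj₁ i≤j = reach-rightward (ℕP.≤⇒≤′ i≤j) j<n
  ... | inj₂ j≤i = reach-leftward (ℕP.≤⇒≤′ j≤i) i<n

straight-isPolyomino : ∀ {n} → 1 ≤ n → IsPolyomino (straight n)
straight-isPolyomino {suc n} _ = straight-unique (suc n) , (λ ()) , straight-connected

instance⇒⊕∈ : ∀ {k P v} → InstanceAt (straight k) P v → ∀ {i} → i < k → v ⊕ i ∈ P
instance⇒⊕∈ {v = v} inst {i} i<k =
  subst (_∈ _) (translate-straight v i) (All.lookup inst (∈-straight⁺ i<k))

⊕∈⇒instance : ∀ {k P v} → (∀ {i} → i < k → v ⊕ i ∈ P) → InstanceAt (straight k) P v
⊕∈⇒instance {k} {v = v} ⊕∈P =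
  AllP.map⁺ (AllP.applyUpTo⁺₁ _ k (λ {i} i<k → subst (_∈ _) (sym (translate-straight v i)) (⊕∈P i<k)))

j<m⇒i<n⇒j+i<m+n∸1 : ∀ {j i m n} → j < m → i < n → j + i < m + n ∸ 1
j<m⇒i<n⇒j+i<m+n∸1 {m = suc m} (s≤s j≤m) i<n = ℕP.+-mono-≤-< j≤m i<n

straight-hasAtLeast : ∀ N k → HasAtLeast N (straight k) (straight (N + k ∸ 1))
straight-hasAtLeast N k =
  straight N , ℕP.≤-reflexive (sym (length-straight N)) , straight-unique N , All.tabulate instanceAt
  where
  instanceAt : ∀ {v} → v ∈ straight N → InstanceAt (straight k) (straight (N + k ∸ 1)) v
  instanceAt v∈ with j , j<N , refl ← ∈-straight⁻ v∈ = ⊕∈⇒instance λ {i} i<k →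
    subst (_∈ straight (N + k ∸ 1)) (cong (_, 0ℤ) (ℤP.pos-+ j i))
      (∈-straight⁺ (j<m⇒i<n⇒j+i<m+n∸1 j<N i<k))

rowMajor : TotalOrder 0ℓ 0ℓ 0ℓ
rowMajor = ×-totalOrder ℤP.≤-decTotalOrder ℤP.≤-totalOrder

open import Data.List.Extrema rowMajor
  using (argmin; argmax; argmin-sel; argmax-sel; f[argmin]≤f[⊤]; f[argmin]≤f[xs]; f[⊥]≤f[argmax]; f[xs]≤f[argmax])

infix 4 _≼_

_≼_ : Cell → Cell → Set
c ≼ d = TotalOrder._≤_ rowMajor (swap c) (swap d)

⊕-≼⇒≤ : ∀ v {i j} → v ⊕ i ≼ v ⊕ j → i ≤ j
⊕-≼⇒≤ (x , y) (inj₁ (_ , y≢y))     = contradiction refl y≢y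
⊕-≼⇒≤ (x , y) (inj₂ (_ , x+i≤x+j)) = ℤP.drop‿+≤+ (+-cancelˡ-≤ x x+i≤x+j)

v⊕suc⋠v : ∀ v i → ¬ (v ⊕ suc i ≼ v)
v⊕suc⋠v v i v⊕1+i≼v with () ← ⊕-≼⇒≤ v (subst (v ⊕ suc i ≼_) (sym (⊕-identityʳ v)) v⊕1+i≼v)

≼-between-⊕ : ∀ u {c} j → u ≼ c → c ≼ u ⊕ j → ∃ λ t → t ≤ j × c ≡ u ⊕ t
≼-between-⊕ (x , y) j (inj₁ (y≤y' , y≢y')) (inj₁ (y'≤y , _)) =
  contradiction (ℤP.≤-antisym y≤y' y'≤y) y≢y'
≼-between-⊕ (x , y) j (inj₁ (_ , y≢y'))    (inj₂ (y'≡y , _)) = contradiction (sym y'≡y) y≢y'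
≼-between-⊕ (x , y) j (inj₂ (refl , x≤x')) c≼u⊕j
  with t , refl ← i≤j⇒∃[n]i+n≡j x≤x' = t , ⊕-≼⇒≤ (x , y) c≼u⊕j , refl

argmin∈ : ∀ {A : Set} (f : A → ℤ × ℤ) v vs → argmin f v vs ∈ v ∷ vs
argmin∈ f v vs with argmin-sel f v vs
... | inj₁ ≡v  = here ≡v
... | inj₂ ∈vs = there ∈vs

argmax∈ : ∀ {A : Set} (f : A → ℤ × ℤ) v vs → argmax f v vs ∈ v ∷ vs
argmax∈ f v vs with argmax-sel f v vs
... | inj₁ ≡v  = here ≡v
... | inj₂ ∈vs = there ∈vs

argmin-least : ∀ v vs → All (argmin swap v vs ≼_) (v ∷ vs)
argmin-least v vs = f[argmin]≤f[⊤] {f = swap} v vs ∷ f[argmin]≤f[xs] v vs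

argmax-greatest : ∀ v vs → All (_≼ argmax swap v vs) (v ∷ vs)
argmax-greatest v vs = f[⊥]≤f[argmax] {f = swap} v vs ∷ f[xs]≤f[argmax] v vs

infix 4 _≟_

_≟_ : DecidableEquality Cell
_≟_ = ≡-dec ℤ._≟_ ℤ._≟_

RightClosedBelow : Cell → List Cell → Set
RightClosedBelow last us = ∀ {u} → u ∈ us → u ≢ last → u ⊕ 1 ∈ us

module _ {us : List Cell} (us-unique : Unique us) {first last : Cell}
         (first-least : All (first ≼_) us) (last-greatest : All (_≼ last) us) where

  first⊕j≡last⇒length≤ : ∀ j → first ⊕ j ≡ last → length us ≤ suc j
  first⊕j≡last⇒length≤ j first⊕j≡last = begin
    length us                             ≤⟨ unique-⊆⇒length≤ us-unique us⊆run ⟩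
    length (applyUpTo (first ⊕_) (suc j)) ≡⟨ length-applyUpTo (first ⊕_) (suc j) ⟩
    suc j                                 ∎
    where
    open ℕP.≤-Reasoning
    us⊆run : us ⊆ applyUpTo (first ⊕_) (suc j)
    us⊆run {u} u∈us
      with t , t≤j , refl ← ≼-between-⊕ first j (All.lookup first-least u∈us)
                              (subst (u ≼_) (sym first⊕j≡last) (All.lookup last-greatest u∈us))
      = ∈-applyUpTo⁺ (first ⊕_) (s≤s t≤j)

  rightClosed⇒run : RightClosedBelow last us → first ∈ us → ∀ {j} → j < length us → first ⊕ j ∈ us
  rightClosed⇒run closed first∈us {zero}  _ = subst (_∈ us) (sym (⊕-identityʳ first)) first∈us
  rightClosed⇒run closed first∈us {suc j} j+1<length with first ⊕ j ≟ last
  ... | yes first⊕j≡last = contradiction (first⊕j≡last⇒length≤ j first⊕j≡last) (ℕP.<⇒≱ j+1<length)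
  ... | no  first⊕j≢last = subst (_∈ us) (⊕-suc first j) (closed first⊕j∈us first⊕j≢last)
    where first⊕j∈us = rightClosed⇒run closed first∈us (ℕP.<-trans (ℕP.n<1+n j) j+1<length)

module Covering {P : List Cell} {k : ℕ} {v₀ : Cell} {vs : List Cell}
  (vs-unique : Unique (v₀ ∷ vs))
  (instances : All (InstanceAt (straight (suc k)) P) (v₀ ∷ vs)) where

  first last : Cell
  first = argmin swap v₀ vs
  last  = argmax swap v₀ vs

  overhang : List Cell
  overhang = applyUpTo (λ i → last ⊕ suc i) k

  cover : List Cell
  cover = (v₀ ∷ vs) ++ overhang

  vs⊆P : v₀ ∷ vs ⊆ P
  vs⊆P {v} v∈vs = subst (_∈ P) (⊕-identityʳ v) (instance⇒⊕∈ (All.lookup instances v∈vs) (s≤s z≤n))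

  overhang⊆P : overhang ⊆ P
  overhang⊆P c∈overhang with i , i<k , refl ← ∈-applyUpTo⁻ _ c∈overhang =
    instance⇒⊕∈ (All.lookup instances (argmax∈ swap v₀ vs)) (s≤s i<k)

  cover⊆P : cover ⊆ P
  cover⊆P c∈cover with ∈-++⁻ (v₀ ∷ vs) c∈cover
  ... | inj₁ c∈vs       = vs⊆P c∈vs
  ... | inj₂ c∈overhang = overhang⊆P c∈overhang

  last⊕suc∉vs : ∀ i → last ⊕ suc i ∉ v₀ ∷ vs
  last⊕suc∉vs i ∈vs = v⊕suc⋠v last i (All.lookup (argmax-greatest v₀ vs) ∈vs)

  cover-unique : Unique cover
  cover-unique = UniqueP.++⁺ vs-unique overhang-unique disjoint
    where
    overhang-unique : Unique overhang
    overhang-unique = UniqueP.applyUpTo⁺₁ _ k λ i<j _ eq →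
      ℕP.<⇒≢ i<j (ℕP.suc-injective (⊕-cancelˡ last eq))
    disjoint : ∀ {c} → ¬ (c ∈ v₀ ∷ vs × c ∈ overhang)
    disjoint (c∈vs , c∈overhang) with i , _ , refl ← ∈-applyUpTo⁻ _ c∈overhang = last⊕suc∉vs i c∈vs

  length-cover : length cover ≡ length (v₀ ∷ vs) + k
  length-cover = trans (length-++ (v₀ ∷ vs)) (cong (λ m → length (v₀ ∷ vs) + m) (length-applyUpTo _ k))

  length-vs+k≤length-P : length (v₀ ∷ vs) + k ≤ length P
  length-vs+k≤length-P = subst (_≤ length P) length-cover (unique-⊆⇒length≤ cover-unique cover⊆P)

  ≢last⇒≢last⊕ : ∀ {u} → u ∈ v₀ ∷ vs → u ≢ last → ∀ i → u ≢ last ⊕ i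
  ≢last⇒≢last⊕ _    u≢last zero    u≡last⊕0 = u≢last (trans u≡last⊕0 (⊕-identityʳ last))
  ≢last⇒≢last⊕ u∈vs _      (suc i) refl     = last⊕suc∉vs i u∈vs

  module Tight (1≤k : 1 ≤ k) (tight : length P ≤ length (v₀ ∷ vs) + k) where

    P⊆cover : P ⊆ cover
    P⊆cover = unique-⊆-length≥⇒⊇ _≟_ cover-unique cover⊆P (subst (length P ≤_) (sym length-cover) tight)

    vs-rightClosed : RightClosedBelow last (v₀ ∷ vs)
    vs-rightClosed {u} u∈vs u≢last
      with ∈-++⁻ (v₀ ∷ vs) (P⊆cover (instance⇒⊕∈ (All.lookup instances u∈vs) (s≤s 1≤k)))
    ... | inj₁ u⊕1∈vs = u⊕1∈vs
    ... | inj₂ u⊕1∈overhang with i , _ , u⊕1≡last⊕suc-i ← ∈-applyUpTo⁻ _ u⊕1∈overhang =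
      contradiction (⊕-cancelʳ 1 (trans u⊕1≡last⊕suc-i (sym (⊕-suc last i))))
        (≢last⇒≢last⊕ u∈vs u≢last i)

    first⊕∈vs : ∀ {j} → j < length (v₀ ∷ vs) → first ⊕ j ∈ v₀ ∷ vs
    first⊕∈vs = rightClosed⇒run vs-unique (argmin-least v₀ vs) (argmax-greatest v₀ vs)
                  vs-rightClosed (argmin∈ swap v₀ vs)

    first⊕∈P : ∀ {t} → t < length P → first ⊕ t ∈ P
    first⊕∈P {t} t<|P| with ℕP.≤-total t (length vs)
    ... | inj₁ t≤|vs| = vs⊆P (first⊕∈vs (s≤s t≤|vs|))
    ... | inj₂ |vs|≤t =
      subst (_∈ P) (trans (⊕-assoc first L (t ∸ L)) (cong (first ⊕_) (ℕP.m+[n∸m]≡n |vs|≤t)))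
        (instance⇒⊕∈ (All.lookup instances (first⊕∈vs (ℕP.n<1+n L))) (ℕP.m<n+o⇒m∸n<o t L t<L+1+k))
      where
      L = length vs
      t<L+1+k : t < L + suc k
      t<L+1+k = subst (t <_) (sym (ℕP.+-suc L k)) (ℕP.<-≤-trans t<|P| tight)

    P-translateOf-straight : TranslateOf (straight (length P)) P
    P-translateOf-straight = first , λ _ → row⊆P , P⊆row
      where
      row : List Cell
      row = map (translate first) (straight (length P))
      row⊆P : row ⊆ P
      row⊆P c∈row
        with c , c∈straight , refl ← ∈-map⁻ _ c∈row
        with t , t<|P| , refl ← ∈-straight⁻ c∈straight
        = subst (_∈ P) (sym (translate-straight first t)) (first⊕∈P t<|P|)
      P⊆row : P ⊆ row
      P⊆row = unique-⊆-length≥⇒⊇ _≟_ (UniqueP.map⁺ (translate-cancelˡ first) (straight-unique _)) row⊆P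
                (ℕP.≤-reflexive (sym (trans (length-map _ (straight (length P))) (length-straight (length P)))))

lemma3p1 : (N k : ℕ) → 1 ≤ N → 2 ≤ k →
    IsPolyomino (straight (N + k ∸ 1))
    × HasAtLeast N (straight k) (straight (N + k ∸ 1))
    × ((P : List Cell) → IsPolyomino P → HasAtLeast N (straight k) P →
         (N + k ∸ 1 ≤ size P)
         × (size P ≡ N + k ∸ 1 → TranslateOf (straight (N + k ∸ 1)) P))
lemma3p1 (suc n) (suc zero) _ (s≤s ())
lemma3p1 (suc n) (suc (suc k)) _ _ =
  straight-isPolyomino (ℕP.≤-trans (s≤s z≤n) (ℕP.m≤n+m (suc (suc k)) n)) ,
  straight-hasAtLeast (suc n) (suc (suc k)) ,
  minimal
  where
  -- Neither bound needs P to be a polyomino: they hold for every list of cells.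
  minimal : (P : List Cell) → IsPolyomino P → HasAtLeast (suc n) (straight (suc (suc k))) P →
            (n + suc (suc k) ≤ size P)
            × (size P ≡ n + suc (suc k) → TranslateOf (straight (n + suc (suc k))) P)
  minimal P _ (v₀ ∷ vs , s≤s n≤|vs| , vs-unique , instances) =
    ℕP.≤-trans n+k≤|vs|+k length-vs+k≤length-P ,
    λ |P|≡n+k → subst (λ m → TranslateOf (straight m) P) |P|≡n+k
                  (Tight.P-translateOf-straight (s≤s z≤n) (ℕP.≤-trans (ℕP.≤-reflexive |P|≡n+k) n+k≤|vs|+k))
    where
    open Covering vs-unique instances
    n+k≤|vs|+k : n + suc (suc k) ≤ length (v₀ ∷ vs) + suc k
    n+k≤|vs|+k = ℕP.≤-trans (ℕP.≤-reflexive (ℕP.+-suc n (suc k))) (s≤s (ℕP.+-monoˡ-≤ (suc k) n≤|vs|))
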